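{- For nonnegative integers $m<n$, let $f(m,n)$ denote the number of relatively prime subsets of $\{m+1,m+2,\ldots,n\}$. Then \[ f(m,n)=\sum_{d=1}^{n}\mu(d)\left(2^{[n/d]-[m/d]}-1\right) \] and \[ 0\le 2^{n-m}-2^{[n/2]-[m/2]}-f(m,n)\le 2n\,2^{[(n-m)/3]}. \]
   Context: A nonempty set $A$ of integers is called relatively prime if $\gcd(A)=1$; in particular the empty set is not relatively prime. $\mu$ denotes the Möbius function. For a real number $x$, $[x]$ denotes the greatest integer not exceeding $x$. -}

module Defs where

open import Data.Bool using (Bool; true; false; if_then_else_)
open import Data.Nat using (ℕ; NonZero; zero; suc; _+_; _*_; _∸_; _^_; _≟_)
open import Data.Nat.Divisibility using (_∣_; _∣?_)
open import Data.Nat.GCD using (gcd)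
open import Data.Nat.Primality using (Prime; prime?)
open import Data.Fin using (Fin; toℕ)
open import Data.Vec using (Vec; []; _∷_)
open import Data.List using (List; []; _∷_; map; _++_; length; filter; foldr; upTo; sum; applyUpTo)
open import Data.Product using (_×_)
open import Data.Integer as ℤ using (ℤ)
open import Relation.Nullary using (¬_; Dec; yes; no)
open import Relation.Nullary.Decidable using (does; _×-dec_; ¬?)
open import Relation.Binary.PropositionalEquality using (_≡_)

-- All subsets of a k-element index set, as characteristic bit-vectors.
allSubsets : (k : ℕ) → List (Vec Bool k)
allSubsets zero = [] ∷ []
allSubsets (suc k) = map (true ∷_) (allSubsets k) ++ map (false ∷_) (allSubsets k)

-- The elements of the set {m+1,...,m+k} selected by a bit-vector of length k.
elems : (m : ℕ) {k : ℕ} → Vec Bool k → List ℕ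
elems m [] = []
elems m (true ∷ v) = suc m ∷ elems (suc m) v
elems m (false ∷ v) = elems (suc m) v

-- gcd of a finite list (gcd of the empty list is 0)
gcdList : List ℕ → ℕ
gcdList = foldr gcd 0

NonEmpty : List ℕ → Set
NonEmpty xs = ¬ (xs ≡ [])

nonEmpty? : (xs : List ℕ) → Dec (NonEmpty xs)
nonEmpty? [] = no (λ f → f _≡_.refl)
nonEmpty? (x ∷ xs) = yes (λ ())

RelPrime : List ℕ → Set
RelPrime xs = NonEmpty xs × gcdList xs ≡ 1

relPrime? : (xs : List ℕ) → Dec (RelPrime xs)
relPrime? xs = nonEmpty? xs ×-dec (gcdList xs ≟ 1)

f : ℕ → ℕ → ℕ
f m n = length (filter (λ s → relPrime? (elems m s)) (allSubsets (n ∸ m)))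

-- Möbius function: μ(d) = 0 if p² ∣ d for some prime p, otherwise
-- (-1)^ω(d), where ω(d) is the number of distinct primes dividing d.
-- (Only primes p ≤ d can divide a positive d.)
primesUpTo : ℕ → List ℕ
primesUpTo d = filter prime? (upTo (suc d))

ω : ℕ → ℕ
ω d = length (filter (λ p → p ∣? d) (primesUpTo d))

squarefree? : ℕ → Bool
squarefree? d = does (length (filter (λ p → (p * p) ∣? d) (primesUpTo d)) ≟ 0)

μ : ℕ → ℤ
μ d = if squarefree? d then (ℤ.-1ℤ) ℤ.^ ω d else ℤ.0ℤ

sumFrom1 : ℕ → ((d : ℕ) → .{{NonZero d}} → ℤ) → ℤ
sumFrom1 n g = foldr ℤ._+_ ℤ.0ℤ (applyUpTo (λ i → g (suc i)) n)

module Submission where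

-- For a list xs of positive integers at most n, the Möbius identity
-- Σ_{d ∣ g} μ(d) = [g = 1] applied to g = gcd xs gives
--   [xs relatively prime] = Σ_{d=1}^{n} μ(d) · [xs ≠ ∅ and d divides every element].
-- Summing over the 2^(n-m) subsets of {m+1,…,n} and exchanging the two sums, the
-- inner sum counts the nonempty subsets of the multiples of d in the interval,
-- namely 2^([n/d]-[m/d]) - 1; this is the formula for f(m,n).  For the inequalities,
-- 2^(n-m) - 2^([n/2]-[m/2]) - f(m,n) is the sum over subsets of the indicator
-- "gcd is odd and at least 3"; it is thus nonnegative, and at most
-- Σ_{d=3}^{n} (2^([n/d]-[m/d]) - 1) ≤ n · 2^(1+[(n-m)/3]).

open import Defs

module Proof where
  open import Data.Bool using (Bool; true; false; if_then_else_)
  open import Data.Nat as ℕ using (ℕ; zero; suc; z≤n; s≤s; NonZero; >-nonZero; _≟_; _≤?_; _/_; _∸_; _^_)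
  import Data.Nat.Properties as ℕP
  open import Data.Nat.DivMod
    using (m≡m%n+[m/n]*n; m%n<n; +-distrib-/-∣ʳ; m<n⇒m/n≡0; m*n/n≡m; /-monoˡ-≤; /-monoʳ-≤; m<n*o⇒m/o<n)
  open import Data.Nat.Divisibility
  open import Data.Nat.GCD using (gcd; gcd[m,n]∣m; gcd[m,n]∣n; gcd-greatest; gcd[m,n]≡0⇒m≡0)
  open import Data.Nat.Coprimality using (Coprime; coprime-divisor)
  open import Data.Nat.Primality
    using (Prime; prime?; ¬prime[0]; ¬prime[1]; prime⇒nonZero; prime⇒irreducible; euclidsLemma)
  open import Data.Nat.Primality.Factorisation using (PrimeFactorisation; factorise)
  open import Data.List using (List; []; _∷_; map; _++_; length; filter; applyUpTo; upTo)
  open import Data.Nat.ListAction using (product)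
  open import Data.List.Properties using (map-applyUpTo)
  open import Data.List.Relation.Unary.All using (All; _∷_)
  open import Data.Vec using (Vec; []; _∷_)
  open import Data.Product using (_×_; _,_; proj₁; proj₂; ∃-syntax)
  open import Data.Sum using (_⊎_; inj₁; inj₂; [_,_]′)
  open import Data.Unit using (⊤; tt)
  open import Data.Empty using (⊥-elim)
  open import Relation.Nullary using (¬_; Dec; yes; no; does)
  open import Relation.Unary using (Pred; Decidable)
  open import Relation.Binary.PropositionalEquality
  open import Data.Integer as ℤ using (ℤ; +_; -_; _+_; _*_; _-_; 0ℤ; 1ℤ; _≤_; +≤+; -≤+)
  import Data.Integer.Properties as ℤP
  open import Data.Nat.Tactic.RingSolver using () renaming (solve-∀ to ℕ-solve)
  open import Algebra.Properties.CommutativeSemigroup ℤP.+-commutativeSemigroup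
    using () renaming (interchange to +-interchange)

  keepIf : ∀ {a} {A : Set a} → Dec A → ℤ → ℤ
  keepIf (yes _) x = x
  keepIf (no _) _ = 0ℤ

  dropIf : ∀ {a} {A : Set a} → Dec A → ℤ → ℤ
  dropIf (yes _) _ = 0ℤ
  dropIf (no _) x = x

  𝟙 : ∀ {a} {A : Set a} → Dec A → ℤ
  𝟙 a? = keepIf a? 1ℤ

  module _ {a} {A : Set a} where

    keepIf-yes : (a? : Dec A) {x : ℤ} → A → keepIf a? x ≡ x
    keepIf-yes (yes _) _ = refl
    keepIf-yes (no ¬a) a = ⊥-elim (¬a a)

    keepIf-no : (a? : Dec A) {x : ℤ} → ¬ A → keepIf a? x ≡ 0ℤ
    keepIf-no (yes a) ¬a = ⊥-elim (¬a a)
    keepIf-no (no _) _ = refl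

    keepIf-zero : (a? : Dec A) → keepIf a? 0ℤ ≡ 0ℤ
    keepIf-zero (yes _) = refl
    keepIf-zero (no _) = refl

    keepIf-neg : (a? : Dec A) (x : ℤ) → keepIf a? (- x) ≡ - keepIf a? x
    keepIf-neg (yes _) _ = refl
    keepIf-neg (no _) _ = refl

    keepIf-nonneg : (a? : Dec A) {x : ℤ} → 0ℤ ≤ x → 0ℤ ≤ keepIf a? x
    keepIf-nonneg (yes _) 0≤x = 0≤x
    keepIf-nonneg (no _) _ = ℤP.≤-refl

    𝟙-nonneg : (a? : Dec A) → 0ℤ ≤ 𝟙 a?
    𝟙-nonneg a? = keepIf-nonneg a? (+≤+ z≤n)

    keepIf-*𝟙 : (a? : Dec A) (x : ℤ) → keepIf a? x ≡ x * 𝟙 a?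
    keepIf-*𝟙 (yes _) x = sym (ℤP.*-identityʳ x)
    keepIf-*𝟙 (no _) x = sym (ℤP.*-zeroʳ x)

    drop+keep : (a? : Dec A) (x : ℤ) → x ≡ dropIf a? x + keepIf a? x
    drop+keep (yes _) x = sym (ℤP.+-identityˡ x)
    drop+keep (no _) x = sym (ℤP.+-identityʳ x)

  keepIf-cong : ∀ {a b} {A : Set a} {B : Set b} (a? : Dec A) (b? : Dec B) {x : ℤ} →
                (A → B) → (B → A) → keepIf a? x ≡ keepIf b? x
  keepIf-cong (yes _) (yes _) _ _ = refl
  keepIf-cong (no _) (no _) _ _ = refl
  keepIf-cong (yes a) (no ¬b) to _ = ⊥-elim (¬b (to a))
  keepIf-cong (no ¬a) (yes b) _ from = ⊥-elim (¬a (from b))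

  𝟙-disjoint-union : ∀ {a b c} {A : Set a} {B : Set b} {C : Set c} (a? : Dec A) (b? : Dec B) (c? : Dec C) →
                     (A → B ⊎ C) → (B → A) → (C → A) → ¬ (B × C) → 𝟙 a? ≡ 𝟙 b? + 𝟙 c?
  𝟙-disjoint-union (yes _) (yes b) (yes c) _ _ _ disjoint = ⊥-elim (disjoint (b , c))
  𝟙-disjoint-union (yes _) (yes _) (no _) _ _ _ _ = refl
  𝟙-disjoint-union (yes _) (no _) (yes _) _ _ _ _ = refl
  𝟙-disjoint-union (yes a) (no ¬b) (no ¬c) split _ _ _ = ⊥-elim ([ ¬b , ¬c ]′ (split a))
  𝟙-disjoint-union (no ¬a) (yes b) _ _ fromB _ _ = ⊥-elim (¬a (fromB b))
  𝟙-disjoint-union (no ¬a) (no _) (yes c) _ _ fromC _ = ⊥-elim (¬a (fromC c))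
  𝟙-disjoint-union (no _) (no _) (no _) _ _ _ _ = refl

  sumTo : ℕ → (ℕ → ℤ) → ℤ
  sumTo zero h = 0ℤ
  sumTo (suc N) h = sumTo N h + h (suc N)

  OnRange : ℕ → (ℕ → Set) → Set
  OnRange N P = ∀ d → 1 ℕ.≤ d → d ℕ.≤ N → P d

  OnRange-init : ∀ {N P} → OnRange (suc N) P → OnRange N P
  OnRange-init P-on d 1≤d d≤N = P-on d 1≤d (ℕP.m≤n⇒m≤1+n d≤N)

  OnRange-last : ∀ {N P} → OnRange (suc N) P → P (suc N)
  OnRange-last P-on = P-on _ (s≤s z≤n) ℕP.≤-refl

  sumTo-cong : ∀ N {g h : ℕ → ℤ} → OnRange N (λ d → g d ≡ h d) → sumTo N g ≡ sumTo N h
  sumTo-cong zero _ = refl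
  sumTo-cong (suc N) g≡h = cong₂ _+_ (sumTo-cong N (OnRange-init g≡h)) (OnRange-last g≡h)

  sumTo-zero : ∀ N {h : ℕ → ℤ} → OnRange N (λ d → h d ≡ 0ℤ) → sumTo N h ≡ 0ℤ
  sumTo-zero zero _ = refl
  sumTo-zero (suc N) h≡0 = cong₂ _+_ (sumTo-zero N (OnRange-init h≡0)) (OnRange-last h≡0)

  sumTo-+ : ∀ N (g h : ℕ → ℤ) → sumTo N (λ d → g d + h d) ≡ sumTo N g + sumTo N h
  sumTo-+ zero g h = refl
  sumTo-+ (suc N) g h =
    trans (cong (_+ (g (suc N) + h (suc N))) (sumTo-+ N g h)) (+-interchange (sumTo N g) (sumTo N h) _ _)

  sumTo-neg : ∀ N (h : ℕ → ℤ) → sumTo N (λ d → - h d) ≡ - sumTo N h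
  sumTo-neg zero h = refl
  sumTo-neg (suc N) h =
    trans (cong (_+ - h (suc N)) (sumTo-neg N h)) (sym (ℤP.neg-distrib-+ (sumTo N h) (h (suc N))))

  sumTo-mono : ∀ N {g h : ℕ → ℤ} → OnRange N (λ d → g d ≤ h d) → sumTo N g ≤ sumTo N h
  sumTo-mono zero _ = ℤP.≤-refl
  sumTo-mono (suc N) g≤h = ℤP.+-mono-≤ (sumTo-mono N (OnRange-init g≤h)) (OnRange-last g≤h)

  sumTo-nonneg : ∀ N {h : ℕ → ℤ} → OnRange N (λ d → 0ℤ ≤ h d) → 0ℤ ≤ sumTo N h
  sumTo-nonneg N {h} 0≤h = subst (_≤ sumTo N h) (sumTo-zero N (λ _ _ _ → refl)) (sumTo-mono N 0≤h)

  sumTo-≥term : ∀ N {h : ℕ → ℤ} → OnRange N (λ d → 0ℤ ≤ h d) → ∀ j → 1 ℕ.≤ j → j ℕ.≤ N → h j ≤ sumTo N h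
  sumTo-≥term zero _ (suc _) _ ()
  sumTo-≥term (suc N) {h} 0≤h j 1≤j j≤1+N with ℕP.m≤n⇒m<n∨m≡n j≤1+N
  ... | inj₂ refl = subst (_≤ sumTo N h + h j) (ℤP.+-identityˡ (h j))
         (ℤP.+-monoˡ-≤ (h j) (sumTo-nonneg N (OnRange-init 0≤h)))
  ... | inj₁ (s≤s j≤N) = subst (_≤ sumTo N h + h (suc N)) (ℤP.+-identityʳ (h j))
         (ℤP.+-mono-≤ (sumTo-≥term N (OnRange-init 0≤h) j 1≤j j≤N) (OnRange-last 0≤h))

  sumTo-const : ∀ N c → sumTo N (λ _ → + c) ≡ + (N ℕ.* c)
  sumTo-const zero c = refl
  sumTo-const (suc N) c =
    trans (cong (_+ + c) (sumTo-const N c)) (cong +_ (ℕP.+-comm (N ℕ.* c) c))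

  sumTo-ext : ∀ {a} N (h : ℕ → ℤ) → a ℕ.≤ N → (∀ d → a ℕ.< d → h d ≡ 0ℤ) → sumTo N h ≡ sumTo a h
  sumTo-ext zero h z≤n _ = refl
  sumTo-ext {a} (suc N) h a≤1+N vanish with ℕP.m≤n⇒m<n∨m≡n a≤1+N
  ... | inj₂ refl = refl
  ... | inj₁ (s≤s a≤N) = begin
    sumTo N h + h (suc N) ≡⟨ cong (_+_ (sumTo N h)) (vanish (suc N) (s≤s a≤N)) ⟩
    sumTo N h + 0ℤ ≡⟨ ℤP.+-identityʳ (sumTo N h) ⟩
    sumTo N h ≡⟨ sumTo-ext N h a≤N vanish ⟩
    sumTo a h ∎
    where open ≡-Reasoning

  sumTo-shift : ∀ N (h : ℕ → ℤ) → sumTo (suc N) h ≡ h 1 + sumTo N (λ d → h (suc d))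
  sumTo-shift zero h = ℤP.+-comm 0ℤ (h 1)
  sumTo-shift (suc N) h =
    trans (cong (_+ h (suc (suc N))) (sumTo-shift N h)) (ℤP.+-assoc (h 1) _ _)

  sumTo-split : ∀ a b (h : ℕ → ℤ) → sumTo (b ℕ.+ a) h ≡ sumTo a h + sumTo b (λ j → h (j ℕ.+ a))
  sumTo-split a zero h = sym (ℤP.+-identityʳ (sumTo a h))
  sumTo-split a (suc b) h =
    trans (cong (_+ h (suc b ℕ.+ a)) (sumTo-split a b h)) (ℤP.+-assoc (sumTo a h) _ _)

  sumTo-delta : ∀ {p} N → 1 ℕ.≤ p → p ℕ.≤ N → sumTo N (λ i → 𝟙 (i ≟ p)) ≡ 1ℤ
  sumTo-delta {suc q} N _ p≤N = begin
    sumTo N δ ≡⟨ sumTo-ext N δ p≤N (λ i p<i → keepIf-no (i ≟ suc q) (λ { refl → ℕP.<-irrefl refl p<i })) ⟩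
    sumTo q δ + 𝟙 (suc q ≟ suc q)
      ≡⟨ cong₂ _+_ (sumTo-zero q (λ i _ i≤q → keepIf-no (i ≟ suc q) (λ { refl → ℕP.<-irrefl refl (s≤s i≤q) })))
                   (keepIf-yes (suc q ≟ suc q) refl) ⟩
    1ℤ ∎
    where
    open ≡-Reasoning
    δ : ℕ → ℤ
    δ i = 𝟙 (i ≟ suc q)

  sumTo-multiples : ∀ q M (G : ℕ → ℤ) →
                    sumTo (M ℕ.* suc q) (λ d → keepIf (suc q ∣? d) (G d)) ≡ sumTo M (λ e → G (e ℕ.* suc q))
  sumTo-multiples q zero G = refl
  sumTo-multiples q (suc M) G = begin
    sumTo (p ℕ.+ M ℕ.* p) F ≡⟨ sumTo-split (M ℕ.* p) p F ⟩
    sumTo (M ℕ.* p) F + sumTo p (λ j → F (j ℕ.+ M ℕ.* p)) ≡⟨ cong₂ _+_ (sumTo-multiples q M G) last-block ⟩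
    sumTo M (λ e → G (e ℕ.* p)) + G (suc M ℕ.* p) ∎
    where
    open ≡-Reasoning
    p : ℕ
    p = suc q
    F : ℕ → ℤ
    F d = keepIf (p ∣? d) (G d)
    -- within the block (M·p, M·p + p] only the last element is a multiple of p
    not-multiple : ∀ j → 1 ℕ.≤ j → j ℕ.≤ q → ¬ p ∣ j ℕ.+ M ℕ.* p
    not-multiple j 1≤j j≤q p∣j+Mp =
      >⇒∤ {{>-nonZero 1≤j}} (s≤s j≤q) (∣m+n∣m⇒∣n (subst (p ∣_) (ℕP.+-comm j (M ℕ.* p)) p∣j+Mp) (n∣m*n M))
    last-block : sumTo p (λ j → F (j ℕ.+ M ℕ.* p)) ≡ G (suc M ℕ.* p)
    last-block = begin
      sumTo q (λ j → F (j ℕ.+ M ℕ.* p)) + F (suc M ℕ.* p)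
        ≡⟨ cong₂ _+_ (sumTo-zero q (λ j 1≤j j≤q → keepIf-no (p ∣? _) (not-multiple j 1≤j j≤q)))
                     (keepIf-yes (p ∣? suc M ℕ.* p) (n∣m*n (suc M))) ⟩
      0ℤ + G (suc M ℕ.* p) ≡⟨ ℤP.+-identityˡ _ ⟩
      G (suc M ℕ.* p) ∎

  sumFrom1≡sumTo : ∀ N (G : (d : ℕ) → .{{NonZero d}} → ℤ) (h : ℕ → ℤ) →
                   (∀ i → G (suc i) ≡ h (suc i)) → sumFrom1 N G ≡ sumTo N h
  sumFrom1≡sumTo zero G h _ = refl
  sumFrom1≡sumTo (suc N) G h G≡h = begin
    G 1 + sumFrom1 N (λ d → G (suc d))
      ≡⟨ cong₂ _+_ (G≡h 0) (sumFrom1≡sumTo N (λ d → G (suc d)) (λ d → h (suc d)) (λ i → G≡h (suc i))) ⟩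
    h 1 + sumTo N (λ d → h (suc d)) ≡⟨ sym (sumTo-shift N h) ⟩
    sumTo (suc N) h ∎
    where open ≡-Reasoning

  sumOver : ∀ {A : Set} → List A → (A → ℤ) → ℤ
  sumOver [] F = 0ℤ
  sumOver (x ∷ xs) F = F x + sumOver xs F

  module _ {A : Set} where

    sumOver-cong : ∀ (xs : List A) {F G : A → ℤ} → (∀ x → F x ≡ G x) → sumOver xs F ≡ sumOver xs G
    sumOver-cong [] _ = refl
    sumOver-cong (x ∷ xs) F≡G = cong₂ _+_ (F≡G x) (sumOver-cong xs F≡G)

    sumOver-zero : ∀ (xs : List A) → sumOver xs (λ _ → 0ℤ) ≡ 0ℤ
    sumOver-zero [] = refl
    sumOver-zero (_ ∷ xs) = trans (ℤP.+-identityˡ _) (sumOver-zero xs)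

    sumOver-++ : ∀ (xs ys : List A) F → sumOver (xs ++ ys) F ≡ sumOver xs F + sumOver ys F
    sumOver-++ [] ys F = sym (ℤP.+-identityˡ _)
    sumOver-++ (x ∷ xs) ys F = trans (cong (_+_ (F x)) (sumOver-++ xs ys F)) (sym (ℤP.+-assoc (F x) _ _))

    sumOver-map : ∀ {B : Set} (g : A → B) (xs : List A) F → sumOver (map g xs) F ≡ sumOver xs (λ x → F (g x))
    sumOver-map g [] F = refl
    sumOver-map g (x ∷ xs) F = cong (_+_ (F (g x))) (sumOver-map g xs F)

    sumOver-+ : ∀ (xs : List A) F G → sumOver xs (λ x → F x + G x) ≡ sumOver xs F + sumOver xs G
    sumOver-+ [] F G = refl
    sumOver-+ (x ∷ xs) F G =
      trans (cong (_+_ (F x + G x)) (sumOver-+ xs F G)) (+-interchange (F x) (G x) _ _)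

    sumOver-neg : ∀ (xs : List A) F → sumOver xs (λ x → - F x) ≡ - sumOver xs F
    sumOver-neg [] F = refl
    sumOver-neg (x ∷ xs) F =
      trans (cong (_+_ (- F x)) (sumOver-neg xs F)) (sym (ℤP.neg-distrib-+ (F x) (sumOver xs F)))

    sumOver-- : ∀ (xs : List A) F G → sumOver xs (λ x → F x - G x) ≡ sumOver xs F - sumOver xs G
    sumOver-- xs F G = trans (sumOver-+ xs F (λ x → - G x)) (cong (_+_ (sumOver xs F)) (sumOver-neg xs G))

    sumOver-* : ∀ (xs : List A) c F → sumOver xs (λ x → c * F x) ≡ c * sumOver xs F
    sumOver-* [] c F = sym (ℤP.*-zeroʳ c)
    sumOver-* (x ∷ xs) c F =
      trans (cong (_+_ (c * F x)) (sumOver-* xs c F)) (sym (ℤP.*-distribˡ-+ c (F x) (sumOver xs F)))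

    sumOver-keepIf : ∀ {a} {B : Set a} (xs : List A) (b? : Dec B) F →
                     sumOver xs (λ x → keepIf b? (F x)) ≡ keepIf b? (sumOver xs F)
    sumOver-keepIf xs (yes _) F = refl
    sumOver-keepIf xs (no _) F = sumOver-zero xs

    sumOver-mono : ∀ (xs : List A) {F G : A → ℤ} → (∀ x → F x ≤ G x) → sumOver xs F ≤ sumOver xs G
    sumOver-mono [] _ = ℤP.≤-refl
    sumOver-mono (x ∷ xs) F≤G = ℤP.+-mono-≤ (F≤G x) (sumOver-mono xs F≤G)

    sumOver-nonneg : ∀ (xs : List A) {F : A → ℤ} → (∀ x → 0ℤ ≤ F x) → 0ℤ ≤ sumOver xs F
    sumOver-nonneg xs 0≤F = subst (_≤ sumOver xs _) (sumOver-zero xs) (sumOver-mono xs 0≤F)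

    sumOver-sumTo : ∀ (xs : List A) N (G : ℕ → A → ℤ) →
                    sumOver xs (λ x → sumTo N (λ d → G d x)) ≡ sumTo N (λ d → sumOver xs (G d))
    sumOver-sumTo [] N G = sym (sumTo-zero N (λ _ _ _ → refl))
    sumOver-sumTo (x ∷ xs) N G =
      trans (cong (_+_ (sumTo N (λ d → G d x))) (sumOver-sumTo xs N G)) (sym (sumTo-+ N (λ d → G d x) _))

    sumOver-filter : ∀ {ℓ} {P : Pred A ℓ} (P? : Decidable P) (xs : List A) F →
                     sumOver (filter P? xs) F ≡ sumOver xs (λ x → keepIf (P? x) (F x))
    sumOver-filter P? [] F = refl
    sumOver-filter P? (x ∷ xs) F with P? x
    ... | yes _ = cong (_+_ (F x)) (sumOver-filter P? xs F)
    ... | no _ = trans (sumOver-filter P? xs F) (sym (ℤP.+-identityˡ _))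

    length-filter : ∀ {ℓ} {P : Pred A ℓ} (P? : Decidable P) (xs : List A) →
                    + length (filter P? xs) ≡ sumOver xs (λ x → 𝟙 (P? x))
    length-filter P? [] = refl
    length-filter P? (x ∷ xs) with P? x
    ... | yes _ = cong (_+_ 1ℤ) (length-filter P? xs)
    ... | no _ = trans (length-filter P? xs) (sym (ℤP.+-identityˡ _))

  sumOver-applyUpTo : ∀ N (h : ℕ → ℤ) → sumOver (applyUpTo suc N) h ≡ sumTo N h
  sumOver-applyUpTo zero h = refl
  sumOver-applyUpTo (suc N) h = begin
    h 1 + sumOver (applyUpTo (λ i → suc (suc i)) N) h
      ≡⟨ cong (λ xs → h 1 + sumOver xs h) (sym (map-applyUpTo suc suc N)) ⟩
    h 1 + sumOver (map suc (applyUpTo suc N)) h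
      ≡⟨ cong (_+_ (h 1)) (trans (sumOver-map suc (applyUpTo suc N) h) (sumOver-applyUpTo N (λ d → h (suc d)))) ⟩
    h 1 + sumTo N (λ d → h (suc d)) ≡⟨ sym (sumTo-shift N h) ⟩
    sumTo (suc N) h ∎
    where open ≡-Reasoning

  -- Counting the primes i ≤ d with a decidable property Q as a range sum
  -- (the index 0 of upTo is not prime).
  primeCount : ∀ {ℓ} {Q : Pred ℕ ℓ} (Q? : Decidable Q) d →
               + length (filter Q? (primesUpTo d)) ≡ sumTo d (λ i → keepIf (prime? i) (𝟙 (Q? i)))
  primeCount Q? d = begin
    + length (filter Q? (primesUpTo d)) ≡⟨ length-filter Q? (primesUpTo d) ⟩
    sumOver (primesUpTo d) (λ i → 𝟙 (Q? i)) ≡⟨ sumOver-filter prime? (upTo (suc d)) _ ⟩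
    0ℤ + sumOver (applyUpTo suc d) (λ i → keepIf (prime? i) (𝟙 (Q? i))) ≡⟨ ℤP.+-identityˡ _ ⟩
    sumOver (applyUpTo suc d) (λ i → keepIf (prime? i) (𝟙 (Q? i))) ≡⟨ sumOver-applyUpTo d _ ⟩
    sumTo d (λ i → keepIf (prime? i) (𝟙 (Q? i))) ∎
    where open ≡-Reasoning

  primeCount-beyond : ∀ {ℓ} {Q : Pred ℕ ℓ} (Q? : Decidable Q) {d} N → d ℕ.≤ N → (∀ i → d ℕ.< i → ¬ Q i) →
                      sumTo N (λ i → keepIf (prime? i) (𝟙 (Q? i))) ≡ + length (filter Q? (primesUpTo d))
  primeCount-beyond Q? {d} N d≤N ¬Q = begin
    sumTo N (λ i → keepIf (prime? i) (𝟙 (Q? i)))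
      ≡⟨ sumTo-ext N _ d≤N (λ i d<i → trans (cong (keepIf (prime? i)) (keepIf-no (Q? i) (¬Q i d<i)))
                                             (keepIf-zero (prime? i))) ⟩
    sumTo d (λ i → keepIf (prime? i) (𝟙 (Q? i))) ≡⟨ sym (primeCount Q? d) ⟩
    + length (filter Q? (primesUpTo d)) ∎
    where open ≡-Reasoning

  squareDivisors : ℕ → ℕ
  squareDivisors d = length (filter (λ p → (p ℕ.* p) ∣? d) (primesUpTo d))

  -- By its definition in Defs, μ d is definitionally μ-form (squareDivisors d) (ω d).
  μ-form : ℕ → ℕ → ℤ
  μ-form s w = if does (s ≟ 0) then ℤ.-1ℤ ℤ.^ w else 0ℤ

  μ-form-suc : ∀ s w → μ-form s (suc w) ≡ - μ-form s w
  μ-form-suc zero w = ℤP.-1*i≡-i (ℤ.-1ℤ ℤ.^ w)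
  μ-form-suc (suc s) w = refl

  μ-form-nonsquarefree : ∀ {s} w → 1 ℕ.≤ s → μ-form s w ≡ 0ℤ
  μ-form-nonsquarefree w (s≤s _) = refl

  prime-divisor-of-prime : ∀ {i p} → Prime p → Prime i → i ∣ p → i ≡ p
  prime-divisor-of-prime pp pi i∣p with prime⇒irreducible pp i∣p
  ... | inj₁ refl = ⊥-elim (¬prime[1] pi)
  ... | inj₂ i≡p = i≡p

  module _ {p e : ℕ} (pp : Prime p) (p∤e : ¬ p ∣ e) where

    prime-divides-product : ∀ {i} → Prime i → i ∣ p ℕ.* e → i ∣ e ⊎ i ≡ p
    prime-divides-product pi i∣pe with euclidsLemma p e pi i∣pe
    ... | inj₁ i∣p = inj₂ (prime-divisor-of-prime pp pi i∣p)
    ... | inj₂ i∣e = inj₁ i∣e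

    square-divides-product : ∀ {i} → Prime i → i ℕ.* i ∣ p ℕ.* e → i ℕ.* i ∣ e
    square-divides-product {i} pi ii∣pe with prime-divides-product pi (∣-trans (m∣m*n i) ii∣pe)
    ... | inj₂ refl = ⊥-elim (p∤e (*-cancelˡ-∣ p {{prime⇒nonZero pp}} ii∣pe))
    ... | inj₁ (divides c refl) with euclidsLemma p c pi
          (*-cancelʳ-∣ i {{prime⇒nonZero pi}} (subst (i ℕ.* i ∣_) (sym (ℕP.*-assoc p c i)) ii∣pe))
    ...   | inj₂ i∣c = *-monoˡ-∣ i i∣c
    ...   | inj₁ i∣p = ⊥-elim (p∤e (subst (_∣ c ℕ.* i) (prime-divisor-of-prime pp pi i∣p) (n∣m*n c)))

    prime-divisor-term : ∀ i → keepIf (prime? i) (𝟙 (i ∣? p ℕ.* e)) ≡ keepIf (prime? i) (𝟙 (i ∣? e)) + 𝟙 (i ≟ p)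
    prime-divisor-term i with prime? i
    ... | no ¬pi = sym (trans (ℤP.+-identityˡ _) (keepIf-no (i ≟ p) (λ { refl → ¬pi pp })))
    ... | yes pi = 𝟙-disjoint-union (i ∣? p ℕ.* e) (i ∣? e) (i ≟ p) (prime-divides-product pi) (∣n⇒∣m*n p)
                     (λ { refl → m∣m*n e }) (λ { (i∣e , refl) → p∤e i∣e })

    square-divisor-term : ∀ i → keepIf (prime? i) (𝟙 (i ℕ.* i ∣? p ℕ.* e)) ≡ keepIf (prime? i) (𝟙 (i ℕ.* i ∣? e))
    square-divisor-term i with prime? i
    ... | no _ = refl
    ... | yes pi = keepIf-cong (i ℕ.* i ∣? p ℕ.* e) (i ℕ.* i ∣? e) (square-divides-product pi) (∣n⇒∣m*n p)

    module _ (1≤e : 1 ℕ.≤ e) where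
      private
        instance
          e≢0 : NonZero e
          e≢0 = >-nonZero 1≤e
          p≢0 : NonZero p
          p≢0 = prime⇒nonZero pp

      ω-prime-multiple : ω (p ℕ.* e) ≡ suc (ω e)
      ω-prime-multiple = ℤP.+-injective (begin
        + ω (p ℕ.* e) ≡⟨ primeCount (_∣? p ℕ.* e) (p ℕ.* e) ⟩
        sumTo (p ℕ.* e) (λ i → keepIf (prime? i) (𝟙 (i ∣? p ℕ.* e)))
          ≡⟨ sumTo-cong (p ℕ.* e) (λ i _ _ → prime-divisor-term i) ⟩
        sumTo (p ℕ.* e) (λ i → keepIf (prime? i) (𝟙 (i ∣? e)) + 𝟙 (i ≟ p)) ≡⟨ sumTo-+ (p ℕ.* e) _ _ ⟩
        sumTo (p ℕ.* e) (λ i → keepIf (prime? i) (𝟙 (i ∣? e))) + sumTo (p ℕ.* e) (λ i → 𝟙 (i ≟ p))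
          ≡⟨ cong₂ _+_ (primeCount-beyond (_∣? e) (p ℕ.* e) (ℕP.m≤n*m e p) (λ i e<i → >⇒∤ e<i))
                       (sumTo-delta (p ℕ.* e) (ℕ.>-nonZero⁻¹ p) (ℕP.m≤m*n p e)) ⟩
        + ω e + 1ℤ ≡⟨ cong +_ (ℕP.+-comm (ω e) 1) ⟩
        + suc (ω e) ∎)
        where open ≡-Reasoning

      squareDivisors-prime-multiple : squareDivisors (p ℕ.* e) ≡ squareDivisors e
      squareDivisors-prime-multiple = ℤP.+-injective (begin
        + squareDivisors (p ℕ.* e) ≡⟨ primeCount (λ i → i ℕ.* i ∣? p ℕ.* e) (p ℕ.* e) ⟩
        sumTo (p ℕ.* e) (λ i → keepIf (prime? i) (𝟙 (i ℕ.* i ∣? p ℕ.* e)))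
          ≡⟨ sumTo-cong (p ℕ.* e) (λ i _ _ → square-divisor-term i) ⟩
        sumTo (p ℕ.* e) (λ i → keepIf (prime? i) (𝟙 (i ℕ.* i ∣? e)))
          ≡⟨ primeCount-beyond (λ i → i ℕ.* i ∣? e) (p ℕ.* e) (ℕP.m≤n*m e p) square-too-big ⟩
        + squareDivisors e ∎)
        where
        open ≡-Reasoning
        square-too-big : ∀ i → e ℕ.< i → ¬ i ℕ.* i ∣ e
        square-too-big i@(suc _) e<i = >⇒∤ (ℕP.<-≤-trans e<i (ℕP.m≤m*n i i))

  -- If p ∣ e then p² ∣ p·e, so p·e is not squarefree.
  squareDivisors-pos : ∀ {p e} → Prime p → p ∣ e → 1 ℕ.≤ e → 1 ℕ.≤ squareDivisors (p ℕ.* e)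
  squareDivisors-pos {p} {e} pp p∣e 1≤e = ℤP.drop‿+≤+ (begin
    1ℤ ≡⟨ sym (trans (keepIf-yes (prime? p) pp) (keepIf-yes (p ℕ.* p ∣? p ℕ.* e) (*-monoʳ-∣ p p∣e))) ⟩
    keepIf (prime? p) (𝟙 (p ℕ.* p ∣? p ℕ.* e))
      ≤⟨ sumTo-≥term (p ℕ.* e) (λ i _ _ → keepIf-nonneg (prime? i) (𝟙-nonneg (i ℕ.* i ∣? p ℕ.* e)))
                     p (ℕ.>-nonZero⁻¹ p) (ℕP.m≤m*n p e) ⟩
    sumTo (p ℕ.* e) (λ i → keepIf (prime? i) (𝟙 (i ℕ.* i ∣? p ℕ.* e)))
      ≡⟨ sym (primeCount (λ i → i ℕ.* i ∣? p ℕ.* e) (p ℕ.* e)) ⟩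
    + squareDivisors (p ℕ.* e) ∎)
    where
    open ℤP.≤-Reasoning
    instance
      p≢0 : NonZero p
      p≢0 = prime⇒nonZero pp
      e≢0 : NonZero e
      e≢0 = >-nonZero 1≤e

  μ-prime-multiple : ∀ {p e} → Prime p → 1 ℕ.≤ e → μ (p ℕ.* e) ≡ - dropIf (p ∣? e) (μ e)
  μ-prime-multiple {p} {e} pp 1≤e with p ∣? e
  ... | yes p∣e = μ-form-nonsquarefree (ω (p ℕ.* e)) (squareDivisors-pos pp p∣e 1≤e)
  ... | no p∤e = begin
    μ-form (squareDivisors (p ℕ.* e)) (ω (p ℕ.* e))
      ≡⟨ cong₂ μ-form (squareDivisors-prime-multiple pp p∤e 1≤e) (ω-prime-multiple pp p∤e 1≤e) ⟩
    μ-form (squareDivisors e) (suc (ω e)) ≡⟨ μ-form-suc (squareDivisors e) (ω e) ⟩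
    - μ e ∎
    where open ≡-Reasoning

  prime-factor : ∀ g → 2 ℕ.≤ g → ∃[ p ] Prime p × p ∣ g
  prime-factor 1 (s≤s ())
  prime-factor g@(suc (suc _)) _ = first-factor (factors fa) (isFactorisation fa) (factorsPrime fa)
    where
    open PrimeFactorisation
    fa : PrimeFactorisation g
    fa = factorise g
    first-factor : ∀ ps → g ≡ product ps → All Prime ps → ∃[ p ] Prime p × p ∣ g
    first-factor (p ∷ ps) g≡Πps (pp ∷ _) = p , pp , subst (p ∣_) (sym g≡Πps) (m∣m*n (product ps))

  -- For g = h·p with p prime, Σ_{d ∣ g} μ(d) = 0: the divisors d with p ∤ d divide h, and the
  -- remaining divisors e·p contribute μ(e·p) = -μ(e) for exactly the same e.
  divisorSum-prime-multiple : ∀ q h → Prime (suc q) → 1 ℕ.≤ h →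
                              sumTo (h ℕ.* suc q) (λ d → keepIf (d ∣? h ℕ.* suc q) (μ d)) ≡ 0ℤ
  divisorSum-prime-multiple q h pp 1≤h = begin
    sumTo hp (λ d → keepIf (d ∣? hp) (μ d))
      ≡⟨ sumTo-cong hp (λ d _ _ → drop+keep (p ∣? d) _) ⟩
    sumTo hp (λ d → dropIf (p ∣? d) (keepIf (d ∣? hp) (μ d)) + keepIf (p ∣? d) (keepIf (d ∣? hp) (μ d)))
      ≡⟨ sumTo-+ hp _ _ ⟩
    sumTo hp (λ d → dropIf (p ∣? d) (keepIf (d ∣? hp) (μ d)))
      + sumTo hp (λ d → keepIf (p ∣? d) (keepIf (d ∣? hp) (μ d)))
      ≡⟨ cong₂ _+_ coprime-part multiple-part ⟩
    X + - X ≡⟨ ℤP.+-inverseʳ X ⟩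
    0ℤ ∎
    where
    open ≡-Reasoning
    p hp : ℕ
    p = suc q
    hp = h ℕ.* p
    instance
      h≢0 : NonZero h
      h≢0 = >-nonZero 1≤h
    T : ℕ → ℤ
    T e = keepIf (e ∣? h) (dropIf (p ∣? e) (μ e))
    X : ℤ
    X = sumTo h T
    coprime-term : ∀ d → dropIf (p ∣? d) (keepIf (d ∣? hp) (μ d)) ≡ keepIf (d ∣? h) (dropIf (p ∣? d) (μ d))
    coprime-term d with p ∣? d
    ... | yes _ = sym (keepIf-zero (d ∣? h))
    ... | no p∤d = keepIf-cong (d ∣? hp) (d ∣? h)
                     (λ d∣hp → coprime-divisor coprime (subst (d ∣_) (ℕP.*-comm h p) d∣hp)) (∣m⇒∣m*n p)
      where
      coprime : Coprime d p
      coprime (i∣d , i∣p) with prime⇒irreducible pp i∣p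
      ... | inj₁ i≡1 = i≡1
      ... | inj₂ refl = ⊥-elim (p∤d i∣d)
    multiple-term : ∀ e → 1 ℕ.≤ e → keepIf (e ℕ.* p ∣? hp) (μ (e ℕ.* p)) ≡ - T e
    multiple-term e 1≤e = begin
      keepIf (e ℕ.* p ∣? hp) (μ (e ℕ.* p))
        ≡⟨ keepIf-cong (e ℕ.* p ∣? hp) (e ∣? h) (*-cancelʳ-∣ p) (*-monoˡ-∣ p) ⟩
      keepIf (e ∣? h) (μ (e ℕ.* p))
        ≡⟨ cong (keepIf (e ∣? h)) (trans (cong μ (ℕP.*-comm e p)) (μ-prime-multiple pp 1≤e)) ⟩
      keepIf (e ∣? h) (- dropIf (p ∣? e) (μ e)) ≡⟨ keepIf-neg (e ∣? h) _ ⟩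
      - T e ∎
    coprime-part : sumTo hp (λ d → dropIf (p ∣? d) (keepIf (d ∣? hp) (μ d))) ≡ X
    coprime-part = trans (sumTo-cong hp (λ d _ _ → coprime-term d))
                         (sumTo-ext hp T (ℕP.m≤m*n h p) (λ d h<d → keepIf-no (d ∣? h) (>⇒∤ h<d)))
    multiple-part : sumTo hp (λ d → keepIf (p ∣? d) (keepIf (d ∣? hp) (μ d))) ≡ - X
    multiple-part = begin
      sumTo hp (λ d → keepIf (p ∣? d) (keepIf (d ∣? hp) (μ d))) ≡⟨ sumTo-multiples q h _ ⟩
      sumTo h (λ e → keepIf (e ℕ.* p ∣? hp) (μ (e ℕ.* p))) ≡⟨ sumTo-cong h (λ e 1≤e _ → multiple-term e 1≤e) ⟩
      sumTo h (λ e → - T e) ≡⟨ sumTo-neg h T ⟩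
      - X ∎

  möbius-identity : ∀ g → 1 ℕ.≤ g → sumTo g (λ d → keepIf (d ∣? g) (μ d)) ≡ 𝟙 (g ≟ 1)
  möbius-identity 1 _ = refl
  möbius-identity g@(suc (suc _)) _ with prime-factor g (s≤s (s≤s z≤n))
  ... | zero , p0 , _ = ⊥-elim (¬prime[0] p0)
  ... | suc q , pp , divides h g≡hp = begin
    sumTo g (λ d → keepIf (d ∣? g) (μ d)) ≡⟨ cong (λ k → sumTo k (λ d → keepIf (d ∣? k) (μ d))) g≡hp ⟩
    sumTo (h ℕ.* suc q) (λ d → keepIf (d ∣? h ℕ.* suc q) (μ d)) ≡⟨ divisorSum-prime-multiple q h pp (1≤h h g≡hp) ⟩
    0ℤ ≡⟨ sym (keepIf-no (g ≟ 1) {1ℤ} (λ ())) ⟩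
    𝟙 (g ≟ 1) ∎
    where
    open ≡-Reasoning
    1≤h : ∀ k → g ≡ k ℕ.* suc q → 1 ℕ.≤ k
    1≤h (suc _) _ = s≤s z≤n

  -- FirstIn lo hi xs: the first element of xs, if any, lies in [lo, hi].  Only the first element
  -- matters below, since the gcd of a list is at most its first element.
  FirstIn : ℕ → ℕ → List ℕ → Set
  FirstIn lo hi [] = ⊤
  FirstIn lo hi (x ∷ _) = lo ℕ.≤ x × x ℕ.≤ hi

  FirstIn-mono : ∀ {lo lo′ hi hi′} → lo′ ℕ.≤ lo → hi ℕ.≤ hi′ →
                 ∀ xs → FirstIn lo hi xs → FirstIn lo′ hi′ xs
  FirstIn-mono _ _ [] tt = tt
  FirstIn-mono lo′≤lo hi≤hi′ (_ ∷ _) (lo≤x , x≤hi) = ℕP.≤-trans lo′≤lo lo≤x , ℕP.≤-trans x≤hi hi≤hi′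

  elems-first : ∀ m {k} (v : Vec Bool k) → FirstIn (suc m) (k ℕ.+ m) (elems m v)
  elems-first m [] = tt
  elems-first m (true ∷ v) = ℕP.≤-refl , s≤s (ℕP.m≤n+m m _)
  elems-first m {suc k} (false ∷ v) =
    FirstIn-mono (ℕP.n≤1+n (suc m)) (ℕP.≤-reflexive (ℕP.+-suc k m)) (elems (suc m) v) (elems-first (suc m) v)

  gcd-range : ∀ {n} x ys → 1 ℕ.≤ x → x ℕ.≤ n → 1 ℕ.≤ gcdList (x ∷ ys) × gcdList (x ∷ ys) ℕ.≤ n
  gcd-range x@(suc _) ys _ x≤n = positive , ℕP.≤-trans (∣⇒≤ (gcd[m,n]∣m x (gcdList ys))) x≤n
    where
    positive : 1 ℕ.≤ gcd x (gcdList ys)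
    positive with gcd x (gcdList ys) in g≡
    ... | zero = ⊥-elim (ℕP.1+n≢0 (gcd[m,n]≡0⇒m≡0 {x} {gcdList ys} g≡))
    ... | suc _ = s≤s z≤n

  -- Indicators of a finite set xs of positive integers: [d divides every element of xs]
  -- (true for the empty list, whose gcd is 0), [xs = ∅], and their difference
  -- [xs ≠ ∅ and d divides every element of xs].
  allDivisible : ℕ → List ℕ → ℤ
  allDivisible d xs = 𝟙 (d ∣? gcdList xs)

  isEmpty : List ℕ → ℤ
  isEmpty [] = 1ℤ
  isEmpty (_ ∷ _) = 0ℤ

  nonemptyMultiples : ℕ → List ℕ → ℤ
  nonemptyMultiples d xs = allDivisible d xs - isEmpty xs

  nonemptyMultiples-nonneg : ∀ d xs → 0ℤ ≤ nonemptyMultiples d xs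
  nonemptyMultiples-nonneg d [] rewrite keepIf-yes (d ∣? 0) {1ℤ} (d ∣0) = ℤP.≤-refl
  nonemptyMultiples-nonneg d xs@(_ ∷ _) = subst (0ℤ ≤_) (sym (ℤP.+-identityʳ _)) (𝟙-nonneg (d ∣? gcdList xs))

  large-multiples-nonneg : ∀ xs d → 0ℤ ≤ keepIf (3 ≤? d) (nonemptyMultiples d xs)
  large-multiples-nonneg xs d = keepIf-nonneg (3 ≤? d) (nonemptyMultiples-nonneg d xs)

  relPrime-möbius : ∀ n xs → FirstIn 1 n xs → 𝟙 (relPrime? xs) ≡ sumTo n (λ d → μ d * nonemptyMultiples d xs)
  relPrime-möbius n [] _ = begin
    𝟙 (relPrime? []) ≡⟨ keepIf-no (relPrime? []) {1ℤ} (λ rp → proj₁ rp refl) ⟩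
    0ℤ ≡⟨ sym (sumTo-zero n λ d _ _ → trans (cong (λ t → μ d * (t - 1ℤ)) (keepIf-yes (d ∣? 0) (d ∣0)))
                                           (ℤP.*-zeroʳ (μ d))) ⟩
    sumTo n (λ d → μ d * nonemptyMultiples d []) ∎
    where open ≡-Reasoning
  relPrime-möbius n xs@(x ∷ ys) (1≤x , x≤n) = begin
    𝟙 (relPrime? xs) ≡⟨ keepIf-cong (relPrime? xs) (g ≟ 1) proj₂ (λ g≡1 → (λ ()) , g≡1) ⟩
    𝟙 (g ≟ 1) ≡⟨ sym (möbius-identity g 1≤g) ⟩
    sumTo g (λ d → keepIf (d ∣? g) (μ d)) ≡⟨ sym (sumTo-ext n _ g≤n (λ d g<d → keepIf-no (d ∣? g) (>⇒∤ g<d))) ⟩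
    sumTo n (λ d → keepIf (d ∣? g) (μ d))
      ≡⟨ sumTo-cong n (λ d _ _ → trans (keepIf-*𝟙 (d ∣? g) (μ d)) (cong (μ d *_) (sym (ℤP.+-identityʳ _)))) ⟩
    sumTo n (λ d → μ d * nonemptyMultiples d xs) ∎
    where
    open ≡-Reasoning
    g : ℕ
    g = gcdList xs
    1≤g : 1 ℕ.≤ g
    1≤g = proj₁ (gcd-range x ys 1≤x x≤n)
    g≤n : g ℕ.≤ n
    g≤n = proj₂ (gcd-range x ys 1≤x x≤n)
    instance
      g≢0 : NonZero g
      g≢0 = >-nonZero 1≤g

  -- excess xs = 1 - [2 ∣ gcd xs] - [xs relatively prime] is the indicator of
  -- "gcd xs is odd and at least 3" (the empty list has gcd 0, which is even).
  excess : List ℕ → ℤ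
  excess xs = 1ℤ - allDivisible 2 xs - 𝟙 (relPrime? xs)

  excess-nonneg : ∀ xs → 0ℤ ≤ excess xs
  excess-nonneg xs = nonneg (2 ∣? gcdList xs) (relPrime? xs)
    where
    nonneg : (two? : Dec (2 ∣ gcdList xs)) (rp? : Dec (RelPrime xs)) → 0ℤ ≤ 1ℤ - 𝟙 two? - 𝟙 rp?
    nonneg (yes 2∣g) (yes (_ , g≡1)) with ∣1⇒≡1 (subst (2 ∣_) g≡1 2∣g)
    ... | ()
    nonneg (yes _) (no _) = +≤+ z≤n
    nonneg (no _) (yes _) = +≤+ z≤n
    nonneg (no _) (no _) = +≤+ z≤n

  odd-≥3 : ∀ {g} → 1 ℕ.≤ g → ¬ g ≡ 1 → ¬ 2 ∣ g → 3 ℕ.≤ g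
  odd-≥3 {1} _ g≢1 _ = ⊥-elim (g≢1 refl)
  odd-≥3 {2} _ _ 2∤g = ⊥-elim (2∤g ∣-refl)
  odd-≥3 {suc (suc (suc _))} _ _ _ = s≤s (s≤s (s≤s z≤n))

  -- If gcd xs is odd and xs is not relatively prime, the term d = gcd xs ≥ 3 of
  -- Σ_{d=3}^{n} [xs ≠ ∅ and d divides every element] already equals 1.
  odd-gcd-count : ∀ n xs → FirstIn 1 n xs → ¬ 2 ∣ gcdList xs → ¬ RelPrime xs →
                  1ℤ ≤ sumTo n (λ d → keepIf (3 ≤? d) (nonemptyMultiples d xs))
  odd-gcd-count n [] _ 2∤0 _ = ⊥-elim (2∤0 (2 ∣0))
  odd-gcd-count n xs@(x ∷ ys) (1≤x , x≤n) 2∤g ¬rp = begin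
    1ℤ ≡⟨ sym (trans (keepIf-yes (3 ≤? g) 3≤g) (cong (_- 0ℤ) (keepIf-yes (g ∣? g) ∣-refl))) ⟩
    keepIf (3 ≤? g) (nonemptyMultiples g xs)
      ≤⟨ sumTo-≥term n (λ d _ _ → large-multiples-nonneg xs d) g 1≤g g≤n ⟩
    sumTo n (λ d → keepIf (3 ≤? d) (nonemptyMultiples d xs)) ∎
    where
    open ℤP.≤-Reasoning
    g : ℕ
    g = gcdList xs
    1≤g : 1 ℕ.≤ g
    1≤g = proj₁ (gcd-range x ys 1≤x x≤n)
    g≤n : g ℕ.≤ n
    g≤n = proj₂ (gcd-range x ys 1≤x x≤n)
    3≤g : 3 ℕ.≤ g
    3≤g = odd-≥3 1≤g (λ g≡1 → ¬rp ((λ ()) , g≡1)) 2∤g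

  -- excess xs ≤ Σ_{d=3}^{n} [xs ≠ ∅ and d divides every element]: either gcd xs is odd
  -- and ≥ 3, or excess xs ≤ 0 while all terms are nonnegative.
  excess-bound : ∀ n xs → FirstIn 1 n xs → excess xs ≤ sumTo n (λ d → keepIf (3 ≤? d) (nonemptyMultiples d xs))
  excess-bound n xs first = bound (2 ∣? gcdList xs) (relPrime? xs)
    where
    terms-nonneg : OnRange n (λ d → 0ℤ ≤ keepIf (3 ≤? d) (nonemptyMultiples d xs))
    terms-nonneg d _ _ = large-multiples-nonneg xs d
    bound : (two? : Dec (2 ∣ gcdList xs)) (rp? : Dec (RelPrime xs)) →
            1ℤ - 𝟙 two? - 𝟙 rp? ≤ sumTo n (λ d → keepIf (3 ≤? d) (nonemptyMultiples d xs))
    bound (yes _) (yes _) = ℤP.≤-trans -≤+ (sumTo-nonneg n terms-nonneg)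
    bound (yes _) (no _) = sumTo-nonneg n terms-nonneg
    bound (no _) (yes _) = sumTo-nonneg n terms-nonneg
    bound (no 2∤g) (no ¬rp) = odd-gcd-count n xs first 2∤g ¬rp

  sumSubsets : ∀ k → (Vec Bool k → ℤ) → ℤ
  sumSubsets k F = sumOver (allSubsets k) F

  sumSubsets-suc : ∀ k F →
                   sumSubsets (suc k) F ≡ sumSubsets k (λ v → F (true ∷ v)) + sumSubsets k (λ v → F (false ∷ v))
  sumSubsets-suc k F = trans (sumOver-++ (map (true ∷_) (allSubsets k)) _ F)
    (cong₂ _+_ (sumOver-map (true ∷_) (allSubsets k) F) (sumOver-map (false ∷_) (allSubsets k) F))

  double : ∀ a → + a + + a ≡ + (2 ℕ.* a)
  double a = cong (λ t → + (a ℕ.+ t)) (sym (ℕP.+-identityʳ a))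

  sumSubsets-one : ∀ k → sumSubsets k (λ _ → 1ℤ) ≡ + (2 ^ k)
  sumSubsets-one zero = refl
  sumSubsets-one (suc k) =
    trans (sumSubsets-suc k _) (trans (cong₂ _+_ (sumSubsets-one k) (sumSubsets-one k)) (double (2 ^ k)))

  sumSubsets-isEmpty : ∀ k m → sumSubsets k (λ v → isEmpty (elems m v)) ≡ 1ℤ
  sumSubsets-isEmpty zero m = refl
  sumSubsets-isEmpty (suc k) m = trans (sumSubsets-suc k _)
    (trans (cong₂ _+_ (sumOver-zero (allSubsets k)) (sumSubsets-isEmpty k (suc m))) (ℤP.+-identityˡ 1ℤ))

  allDivisible-cons : ∀ d x xs → allDivisible d (x ∷ xs) ≡ keepIf (d ∣? x) (allDivisible d xs)
  allDivisible-cons d x xs with d ∣? x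
  ... | yes d∣x = keepIf-cong (d ∣? gcd x (gcdList xs)) (d ∣? gcdList xs)
                    (λ d∣g → ∣-trans d∣g (gcd[m,n]∣n x (gcdList xs))) (gcd-greatest d∣x)
  ... | no d∤x = keepIf-no (d ∣? gcd x (gcdList xs)) (λ d∣g → d∤x (∣-trans d∣g (gcd[m,n]∣m x (gcdList xs))))

  -- multiplesIn d lo hi = ⌊hi/d⌋ - ⌊lo/d⌋, the number of multiples of d in (lo, hi].
  multiplesIn : (d : ℕ) .{{_ : NonZero d}} → ℕ → ℕ → ℕ
  multiplesIn d lo hi = hi / d ∸ lo / d

  -- ⌊(m+1)/d⌋ exceeds ⌊m/d⌋, by one, exactly when d ∣ m+1.  Write m = r + q·d with r < d:
  -- if r + 1 < d then m + 1 = (r+1) + q·d is not a multiple of d, otherwise m + 1 = (q+1)·d.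
  floor-suc : ∀ m d .{{_ : NonZero d}} → (d ∣ suc m × suc m / d ≡ suc (m / d)) ⊎ (¬ d ∣ suc m × suc m / d ≡ m / d)
  floor-suc m d with ℕP.m≤n⇒m<n∨m≡n (m%n<n m d)
  ... | inj₁ r+1<d = inj₂ (d∤ , quotient-same)
    where
    open ≡-Reasoning
    r q : ℕ
    r = m ℕ.% d
    q = m / d
    suc-m≡ : suc m ≡ suc r ℕ.+ q ℕ.* d
    suc-m≡ = cong suc (m≡m%n+[m/n]*n m d)
    quotient-same : suc m / d ≡ q
    quotient-same = begin
      suc m / d ≡⟨ cong (_/ d) suc-m≡ ⟩
      (suc r ℕ.+ q ℕ.* d) / d ≡⟨ +-distrib-/-∣ʳ (suc r) (n∣m*n q) ⟩
      suc r / d ℕ.+ q ℕ.* d / d ≡⟨ cong₂ ℕ._+_ (m<n⇒m/n≡0 r+1<d) (m*n/n≡m q d) ⟩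
      q ∎
    d∤ : ¬ d ∣ suc m
    d∤ d∣ = >⇒∤ r+1<d (∣m+n∣m⇒∣n (subst (d ∣_) (trans suc-m≡ (ℕP.+-comm (suc r) (q ℕ.* d))) d∣) (n∣m*n q))
  ... | inj₂ r+1≡d =
    inj₁ (subst (d ∣_) (sym suc-m≡) (n∣m*n (suc q)) , trans (cong (_/ d) suc-m≡) (m*n/n≡m (suc q) d))
    where
    q : ℕ
    q = m / d
    suc-m≡ : suc m ≡ suc q ℕ.* d
    suc-m≡ = trans (cong suc (m≡m%n+[m/n]*n m d)) (cong (ℕ._+ q ℕ.* d) r+1≡d)

  multiplesIn-step : ∀ d .{{_ : NonZero d}} k m →
      (d ∣ suc m × multiplesIn d m (suc k ℕ.+ m) ≡ suc (multiplesIn d (suc m) (k ℕ.+ suc m)))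
    ⊎ (¬ d ∣ suc m × multiplesIn d m (suc k ℕ.+ m) ≡ multiplesIn d (suc m) (k ℕ.+ suc m))
  multiplesIn-step d k m with floor-suc m d
  ... | inj₁ (d∣ , up) = inj₁ (d∣ , (begin
    top / d ∸ m / d ≡⟨ ℕP.+-∸-assoc 1 (subst (ℕ._≤ top / d) up (/-monoˡ-≤ d (s≤s (ℕP.m≤n+m m k)))) ⟩
    suc (top / d ∸ suc (m / d)) ≡⟨ cong (λ t → suc (top / d ∸ t)) (sym up) ⟩
    suc (top / d ∸ suc m / d) ≡⟨ cong (λ t → suc (t / d ∸ suc m / d)) (sym (ℕP.+-suc k m)) ⟩
    suc ((k ℕ.+ suc m) / d ∸ suc m / d) ∎))
    where
    open ≡-Reasoning
    top : ℕ
    top = suc k ℕ.+ m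
  ... | inj₂ (d∤ , same) = inj₂ (d∤ , (begin
    top / d ∸ m / d ≡⟨ cong (top / d ∸_) (sym same) ⟩
    top / d ∸ suc m / d ≡⟨ cong (λ t → t / d ∸ suc m / d) (sym (ℕP.+-suc k m)) ⟩
    (k ℕ.+ suc m) / d ∸ suc m / d ∎))
    where
    open ≡-Reasoning
    top : ℕ
    top = suc k ℕ.+ m

  -- The subsets of {m+1, …, k+m} all of whose elements are divisible by d are the subsets
  -- of the multiples of d in that interval: there are 2^(multiplesIn d m (k+m)) of them.
  sumSubsets-allDivisible : ∀ d .{{_ : NonZero d}} k m →
      sumSubsets k (λ v → allDivisible d (elems m v)) ≡ + (2 ^ multiplesIn d m (k ℕ.+ m))
  sumSubsets-allDivisible d zero m =
    trans (ℤP.+-identityʳ _) (trans (keepIf-yes (d ∣? 0) (d ∣0)) (cong (λ t → + (2 ^ t)) (sym (ℕP.n∸n≡0 (m / d)))))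
  sumSubsets-allDivisible d (suc k) m = begin
    sumSubsets (suc k) (λ v → allDivisible d (elems m v)) ≡⟨ sumSubsets-suc k _ ⟩
    sumSubsets k (λ v → allDivisible d (suc m ∷ elems (suc m) v)) + R
      ≡⟨ cong (_+ R) (trans (sumOver-cong (allSubsets k) (λ v → allDivisible-cons d (suc m) (elems (suc m) v)))
                            (sumOver-keepIf (allSubsets k) (d ∣? suc m) _)) ⟩
    keepIf (d ∣? suc m) R + R ≡⟨ cong (λ t → keepIf (d ∣? suc m) t + t) (sumSubsets-allDivisible d k (suc m)) ⟩
    keepIf (d ∣? suc m) (+ (2 ^ E)) + + (2 ^ E) ≡⟨ step (multiplesIn-step d k m) ⟩
    + (2 ^ multiplesIn d m (suc k ℕ.+ m)) ∎
    where
    open ≡-Reasoning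
    R : ℤ
    R = sumSubsets k (λ v → allDivisible d (elems (suc m) v))
    E M : ℕ
    E = multiplesIn d (suc m) (k ℕ.+ suc m)
    M = multiplesIn d m (suc k ℕ.+ m)
    -- m+1 may be added to each counted subset exactly when d ∣ m+1
    step : (d ∣ suc m × M ≡ suc E) ⊎ (¬ d ∣ suc m × M ≡ E) → keepIf (d ∣? suc m) (+ (2 ^ E)) + + (2 ^ E) ≡ + (2 ^ M)
    step (inj₁ (d∣ , M≡)) =
      trans (cong (_+ + (2 ^ E)) (keepIf-yes (d ∣? suc m) d∣)) (trans (double (2 ^ E)) (cong (λ t → + (2 ^ t)) (sym M≡)))
    step (inj₂ (d∤ , M≡)) =
      trans (cong (_+ + (2 ^ E)) (keepIf-no (d ∣? suc m) d∤)) (trans (ℤP.+-identityˡ _) (cong (λ t → + (2 ^ t)) (sym M≡)))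

  -- ⌊(a+b)/d⌋ ≤ ⌊a/d⌋ + ⌊b/d⌋ + 1, since a + b < (⌊a/d⌋ + ⌊b/d⌋ + 2)·d.
  floor-+ : ∀ a b d .{{_ : NonZero d}} → (a ℕ.+ b) / d ℕ.≤ suc (a / d ℕ.+ b / d)
  floor-+ a b d = ℕP.≤-pred (m<n*o⇒m/o<n (begin-strict
    a ℕ.+ b <⟨ ℕP.+-mono-<-≤ (below a) (ℕP.<⇒≤ (below b)) ⟩
    (a / d ℕ.* d ℕ.+ d) ℕ.+ (b / d ℕ.* d ℕ.+ d) ≡⟨ regroup (a / d) (b / d) d ⟩
    suc (suc (a / d ℕ.+ b / d)) ℕ.* d ∎))
    where
    open ℕP.≤-Reasoning
    below : ∀ x → x ℕ.< x / d ℕ.* d ℕ.+ d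
    below x = subst (ℕ._< x / d ℕ.* d ℕ.+ d) (trans (ℕP.+-comm _ (x ℕ.% d)) (sym (m≡m%n+[m/n]*n x d)))
                (ℕP.+-monoʳ-< (x / d ℕ.* d) (m%n<n x d))
    regroup : ∀ p q d → (p ℕ.* d ℕ.+ d) ℕ.+ (q ℕ.* d ℕ.+ d) ≡ suc (suc (p ℕ.+ q)) ℕ.* d
    regroup = ℕ-solve

  multiplesIn-bound : ∀ d .{{_ : NonZero d}} {m n} → m ℕ.≤ n → 3 ℕ.≤ d → multiplesIn d m n ℕ.≤ suc ((n ∸ m) / 3)
  multiplesIn-bound d {m} {n} m≤n 3≤d =
    ℕP.≤-trans (ℕP.m≤n+o⇒m∸n≤o (n / d) (m / d) n/d≤) (s≤s (/-monoʳ-≤ (n ∸ m) 3≤d))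
    where
    open ℕP.≤-Reasoning
    n/d≤ : n / d ℕ.≤ m / d ℕ.+ suc ((n ∸ m) / d)
    n/d≤ = begin
      n / d ≡⟨ cong (_/ d) (sym (ℕP.m∸n+n≡m m≤n)) ⟩
      (n ∸ m ℕ.+ m) / d ≤⟨ floor-+ (n ∸ m) m d ⟩
      suc ((n ∸ m) / d ℕ.+ m / d) ≡⟨ cong suc (ℕP.+-comm ((n ∸ m) / d) (m / d)) ⟩
      suc (m / d ℕ.+ (n ∸ m) / d) ≡⟨ sym (ℕP.+-suc (m / d) ((n ∸ m) / d)) ⟩
      m / d ℕ.+ suc ((n ∸ m) / d) ∎

  module Interval (m n : ℕ) (m≤n : m ℕ.≤ n) where

    subsetSum : (List ℕ → ℤ) → ℤ
    subsetSum F = sumSubsets (n ∸ m) (λ v → F (elems m v))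

    multiples : ℕ → ℕ
    multiples zero = 0
    multiples d@(suc _) = multiplesIn d m n

    first-in-range : ∀ (v : Vec Bool (n ∸ m)) → FirstIn 1 n (elems m v)
    first-in-range v = FirstIn-mono (s≤s z≤n) (ℕP.≤-reflexive (ℕP.m∸n+n≡m m≤n)) (elems m v) (elems-first m v)

    count-relPrime : + f m n ≡ subsetSum (λ xs → 𝟙 (relPrime? xs))
    count-relPrime = length-filter (λ v → relPrime? (elems m v)) (allSubsets (n ∸ m))

    count-allDivisible : ∀ d → 1 ℕ.≤ d → subsetSum (allDivisible d) ≡ + (2 ^ multiples d)
    count-allDivisible d@(suc _) _ =
      trans (sumSubsets-allDivisible d (n ∸ m) m) (cong (λ t → + (2 ^ multiplesIn d m t)) (ℕP.m∸n+n≡m m≤n))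

    count-nonemptyMultiples : ∀ d → 1 ℕ.≤ d → subsetSum (nonemptyMultiples d) ≡ + (2 ^ multiples d) - 1ℤ
    count-nonemptyMultiples d 1≤d = trans (sumOver-- (allSubsets (n ∸ m)) _ _)
      (cong₂ _-_ (count-allDivisible d 1≤d) (sumSubsets-isEmpty (n ∸ m) m))

    formula : + f m n ≡ sumFrom1 n (λ d → μ d * (+ (2 ^ (n / d ∸ m / d)) - 1ℤ))
    formula = begin
      + f m n ≡⟨ count-relPrime ⟩
      subsetSum (λ xs → 𝟙 (relPrime? xs))
        ≡⟨ sumOver-cong (allSubsets (n ∸ m)) (λ v → relPrime-möbius n (elems m v) (first-in-range v)) ⟩
      subsetSum (λ xs → sumTo n (λ d → μ d * nonemptyMultiples d xs)) ≡⟨ sumOver-sumTo (allSubsets (n ∸ m)) n _ ⟩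
      sumTo n (λ d → subsetSum (λ xs → μ d * nonemptyMultiples d xs))
        ≡⟨ sumTo-cong n (λ d 1≤d _ → trans (sumOver-* (allSubsets (n ∸ m)) (μ d) _)
                                            (cong (μ d *_) (count-nonemptyMultiples d 1≤d))) ⟩
      sumTo n (λ d → μ d * (+ (2 ^ multiples d) - 1ℤ))
        ≡⟨ sym (sumFrom1≡sumTo n (λ d → μ d * (+ (2 ^ (n / d ∸ m / d)) - 1ℤ)) _ (λ _ → refl)) ⟩
      sumFrom1 n (λ d → μ d * (+ (2 ^ (n / d ∸ m / d)) - 1ℤ)) ∎
      where open ≡-Reasoning

    total-excess : subsetSum excess ≡ + (2 ^ (n ∸ m)) - + (2 ^ (n / 2 ∸ m / 2)) - + f m n
    total-excess = begin
      subsetSum excess ≡⟨ sumOver-- (allSubsets (n ∸ m)) _ _ ⟩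
      subsetSum (λ xs → 1ℤ - allDivisible 2 xs) - subsetSum (λ xs → 𝟙 (relPrime? xs))
        ≡⟨ cong₂ _-_ (sumOver-- (allSubsets (n ∸ m)) _ _) (sym count-relPrime) ⟩
      subsetSum (λ _ → 1ℤ) - subsetSum (allDivisible 2) - + f m n
        ≡⟨ cong₂ (λ a b → a - b - + f m n) (sumSubsets-one (n ∸ m)) (count-allDivisible 2 (s≤s z≤n)) ⟩
      + (2 ^ (n ∸ m)) - + (2 ^ (n / 2 ∸ m / 2)) - + f m n ∎
      where open ≡-Reasoning

    excess-total-nonneg : 0ℤ ≤ + (2 ^ (n ∸ m)) - + (2 ^ (n / 2 ∸ m / 2)) - + f m n
    excess-total-nonneg = subst (0ℤ ≤_) total-excess (sumOver-nonneg (allSubsets (n ∸ m)) (λ v → excess-nonneg (elems m v)))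

    term-bound : ∀ d → keepIf (3 ≤? d) (+ (2 ^ multiples d) - 1ℤ) ≤ + (2 ^ suc ((n ∸ m) / 3))
    term-bound d with 3 ≤? d
    ... | no _ = +≤+ z≤n
    ... | yes 3≤d = ℤP.i≤j⇒i-k≤j (+ 1) (+≤+ (ℕP.^-monoʳ-≤ 2 (multiples-bound d 3≤d)))
      where
      multiples-bound : ∀ d → 3 ℕ.≤ d → multiples d ℕ.≤ suc ((n ∸ m) / 3)
      multiples-bound d@(suc _) 3≤d = multiplesIn-bound d m≤n 3≤d

    excess-total-bound : + (2 ^ (n ∸ m)) - + (2 ^ (n / 2 ∸ m / 2)) - + f m n ≤ + (2 ℕ.* n ℕ.* 2 ^ ((n ∸ m) / 3))
    excess-total-bound = begin
      + (2 ^ (n ∸ m)) - + (2 ^ (n / 2 ∸ m / 2)) - + f m n ≡⟨ sym total-excess ⟩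
      subsetSum excess ≤⟨ sumOver-mono (allSubsets (n ∸ m)) (λ v → excess-bound n (elems m v) (first-in-range v)) ⟩
      subsetSum (λ xs → sumTo n (λ d → keepIf (3 ≤? d) (nonemptyMultiples d xs)))
        ≡⟨ sumOver-sumTo (allSubsets (n ∸ m)) n _ ⟩
      sumTo n (λ d → subsetSum (λ xs → keepIf (3 ≤? d) (nonemptyMultiples d xs)))
        ≡⟨ sumTo-cong n (λ d 1≤d _ → trans (sumOver-keepIf (allSubsets (n ∸ m)) (3 ≤? d) _)
                                            (cong (keepIf (3 ≤? d)) (count-nonemptyMultiples d 1≤d))) ⟩
      sumTo n (λ d → keepIf (3 ≤? d) (+ (2 ^ multiples d) - 1ℤ)) ≤⟨ sumTo-mono n (λ d _ _ → term-bound d) ⟩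
      sumTo n (λ _ → + (2 ^ suc ((n ∸ m) / 3))) ≡⟨ sumTo-const n _ ⟩
      + (n ℕ.* (2 ℕ.* 2 ^ ((n ∸ m) / 3)))
        ≡⟨ cong +_ (trans (sym (ℕP.*-assoc n 2 _)) (cong (ℕ._* 2 ^ ((n ∸ m) / 3)) (ℕP.*-comm n 2))) ⟩
      + (2 ℕ.* n ℕ.* 2 ^ ((n ∸ m) / 3)) ∎
      where open ℤP.≤-Reasoning

open import Data.Nat using (ℕ; suc; _<_; _∸_; _^_; _/_; _*_)
open import Data.Nat.Properties using (<⇒≤)
open import Data.Integer as ℤ using (ℤ; +_; _-_; _≤_)
open import Data.Product using (_×_; _,_)
open import Relation.Binary.PropositionalEquality using (_≡_)

theorem1 : (m n : ℕ) → m < n →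
    (+ f m n ≡ sumFrom1 n (λ d → μ d ℤ.* (+ (2 ^ (n / d ∸ m / d)) - + 1)))
    × (+ 0 ≤ + (2 ^ (n ∸ m)) - + (2 ^ (n / 2 ∸ m / 2)) - + f m n)
    × (+ (2 ^ (n ∸ m)) - + (2 ^ (n / 2 ∸ m / 2)) - + f m n ≤ + (2 * n * 2 ^ ((n ∸ m) / 3)))
theorem1 m n m<n = formula , excess-total-nonneg , excess-total-bound
  where open Proof.Interval m n (<⇒≤ m<n)
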